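{- Let $0\le a\le 2^n$ and let $S\subseteq Q_n$ with $|S|=a$. Then $m(I_a)=m(S)$ if and only if $I_a=S$.
   Context: $Q_n=\{0,1\}^n$ is the set of binary strings $x=x_0x_1\ldots x_{n-1}$, each identified with the integer $\sum_i x_i2^{n-1-i}$. For $0\le k\le 2^n$, $I_k\subseteq Q_n$ is the set of strings with integer value $<k$. For $S\subseteq Q_n$, $m_i(S)$ is the number of $x\in S$ with $x_i=1$ ($0\le i\le n-1$), and $m(S)=(m_0(S),\ldots,m_{n-1}(S))$. -}

module Defs where

open import Data.Bool using (Bool; true; false; if_then_else_; _∧_)
open import Data.Nat using (ℕ; zero; suc; _+_; _^_; _<ᵇ_; _/_; _%_; _≤_)
open import Data.Fin using (Fin; toℕ)
open import Data.Fin.Subset using (Subset)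
open import Data.Vec using (Vec; []; _∷_; _∷ʳ_; tabulate; lookup)

-- Binary string of length n of the integer k, most significant bit first:
-- (last bit = k mod 2, preceded by the n-1 bits of ⌊k/2⌋)
-- toBits n k = x_0 x_1 ... x_{n-1} with k ≡ Σ_i x_i 2^(n-1-i)  (for k < 2^n).
toBits : (n : ℕ) → ℕ → Vec Bool n
toBits zero    k = []
toBits (suc n) k = toBits n (k / 2) ∷ʳ ((k % 2) Data.Nat.≡ᵇ 1)

-- Q_n is identified with Fin (2 ^ n) via the integer value; a subset
-- S ⊆ Q_n is a characteristic vector (Data.Fin.Subset).
Qn : ℕ → Set
Qn n = Fin (2 ^ n)

str : (n : ℕ) → Qn n → Vec Bool n
str n x = toBits n (toℕ x)

I : (n k : ℕ) → Subset (2 ^ n)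
I n k = tabulate (λ x → toℕ x <ᵇ k)

count : {N : ℕ} → (Fin N → Bool) → ℕ
count {zero}  p = 0
count {suc N} p = (if p Data.Fin.zero then 1 else 0) + count {N} (λ j → p (Data.Fin.suc j))

mᵢ : (n : ℕ) → Subset (2 ^ n) → Fin n → ℕ
mᵢ n S i = count (λ x → lookup S x ∧ lookup (str n x) i)

m : (n : ℕ) → Subset (2 ^ n) → Vec ℕ n
m n S = tabulate (mᵢ n S)

{-# OPTIONS --safe #-}
-- Weighting m_i(S) by 2^(n-1-i) and summing over i gives the sum of the integer values of the
-- elements of S. Among all subsets of {0, …, N-1} with a elements, the initial segment
-- {0, …, a-1} is the unique one with the least element sum; hence m(S) = m(I_a) forces S = I_a.
module Submission where

open import Defs
open import Data.Nat using (ℕ; _^_; _≤_)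
open import Data.Fin.Subset using (Subset; ∣_∣)
open import Relation.Binary.PropositionalEquality using (_≡_)
open import Function.Bundles using (_⇔_)

open import Data.Bool using (Bool; true; false; if_then_else_; _∧_)
open import Data.Nat using (zero; suc; _+_; _*_; _<_; _<ᵇ_; _/_; _%_; _≡ᵇ_; z≤n; s≤s)
open import Data.Nat.Properties
open import Data.Nat.DivMod using (m≡m%n+[m/n]*n; m%n<n; m<n*o⇒m/o<n)
open import Data.Nat.Tactic.RingSolver using (solve-∀)
open import Data.Fin using (Fin; zero; suc; toℕ)
open import Data.Fin.Properties using (toℕ<n)
open import Data.Vec using (Vec; []; _∷_; _∷ʳ_; tabulate; lookup; map)
open import Data.Vec.Properties using (map-∷ʳ; tabulate-∘; tabulate∘lookup; tabulate-cong)
open import Algebra.Properties.Semiring.Sum +-*-semiring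
  using (sum-syntax; sum-cong-≗; sum-replicate-zero; ∑-distrib-+; *-distribʳ-sum)
open import Relation.Binary.PropositionalEquality
  using (refl; sym; trans; cong; cong₂; subst; module ≡-Reasoning)
open import Relation.Nullary.Negation using (contradiction)
open import Function.Bundles using (mk⇔)

𝟙 : Bool → ℕ
𝟙 b = if b then 1 else 0

count≡∑ : ∀ {N} (p : Fin N → Bool) → count p ≡ ∑[ x < N ] 𝟙 (p x)
count≡∑ {zero}  p = refl
count≡∑ {suc N} p = cong (𝟙 (p zero) +_) (count≡∑ (λ x → p (suc x)))

∣p∣≡∑ : ∀ {N} (p : Subset N) → ∣ p ∣ ≡ ∑[ x < N ] 𝟙 (lookup p x)
∣p∣≡∑ []          = refl
∣p∣≡∑ (true  ∷ p) = cong suc (∣p∣≡∑ p)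
∣p∣≡∑ (false ∷ p) = ∣p∣≡∑ p

-- The sum of the elements of p: deleting position 0 lowers each remaining element by one.
elementSum : ∀ {N} → Subset N → ℕ
elementSum []      = 0
elementSum (_ ∷ p) = ∣ p ∣ + elementSum p

elementSum≡∑ : ∀ {N} (p : Subset N) → elementSum p ≡ ∑[ x < N ] (𝟙 (lookup p x) * toℕ x)
elementSum≡∑ []      = refl
elementSum≡∑ {suc N} (b ∷ p) = begin
  ∣ p ∣ + elementSum p
    ≡⟨ cong₂ _+_ (∣p∣≡∑ p) (elementSum≡∑ p) ⟩
  ∑[ x < N ] 𝟙 (lookup p x) + ∑[ x < N ] (𝟙 (lookup p x) * toℕ x)
    ≡⟨ ∑-distrib-+ (λ x → 𝟙 (lookup p x)) (λ x → 𝟙 (lookup p x) * toℕ x) ⟨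
  ∑[ x < N ] (𝟙 (lookup p x) + 𝟙 (lookup p x) * toℕ x)
    ≡⟨ sum-cong-≗ (λ x → sym (*-suc (𝟙 (lookup p x)) (toℕ x))) ⟩
  ∑[ x < N ] (𝟙 (lookup p x) * suc (toℕ x))
    ≡⟨ cong (_+ ∑[ x < N ] (𝟙 (lookup p x) * suc (toℕ x))) (*-zeroʳ (𝟙 b)) ⟨
  𝟙 b * 0 + ∑[ x < N ] (𝟙 (lookup p x) * suc (toℕ x))
    ∎
  where open ≡-Reasoning

binaryValue : ∀ {n} → Vec ℕ n → ℕ
binaryValue []               = 0
binaryValue {suc n} (d ∷ ds) = d * 2 ^ n + binaryValue ds

binaryValue-∷ʳ : ∀ {n} (ds : Vec ℕ n) d → binaryValue (ds ∷ʳ d) ≡ 2 * binaryValue ds + d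
binaryValue-∷ʳ []               d = trans (+-identityʳ (d * 1)) (*-identityʳ d)
binaryValue-∷ʳ {suc n} (e ∷ ds) d =
  trans (cong (e * 2 ^ suc n +_) (binaryValue-∷ʳ ds d)) (shift e (2 ^ n) (binaryValue ds) d)
  where
  shift : ∀ e p v d → e * (2 * p) + (2 * v + d) ≡ 2 * (e * p + v) + d
  shift = solve-∀

𝟙[r≡ᵇ1]≡r : ∀ {r} → r < 2 → 𝟙 (r ≡ᵇ 1) ≡ r
𝟙[r≡ᵇ1]≡r {zero}        _ = refl
𝟙[r≡ᵇ1]≡r {suc zero}    _ = refl
𝟙[r≡ᵇ1]≡r {suc (suc r)} (s≤s (s≤s ()))

binaryValue-toBits : ∀ n k → k < 2 ^ n → binaryValue (map 𝟙 (toBits n k)) ≡ k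
binaryValue-toBits zero    zero    _         = refl
binaryValue-toBits zero    (suc k) (s≤s ())
binaryValue-toBits (suc n) k       k<2^[1+n] = begin
  binaryValue (map 𝟙 (toBits n (k / 2) ∷ʳ (k % 2 ≡ᵇ 1)))
    ≡⟨ cong binaryValue (map-∷ʳ 𝟙 _ (toBits n (k / 2))) ⟩
  binaryValue (map 𝟙 (toBits n (k / 2)) ∷ʳ 𝟙 (k % 2 ≡ᵇ 1))
    ≡⟨ binaryValue-∷ʳ (map 𝟙 (toBits n (k / 2))) _ ⟩
  2 * binaryValue (map 𝟙 (toBits n (k / 2))) + 𝟙 (k % 2 ≡ᵇ 1)
    ≡⟨ cong₂ (λ q r → 2 * q + r) (binaryValue-toBits n (k / 2) k/2<2^n)
                                 (𝟙[r≡ᵇ1]≡r (m%n<n k 2)) ⟩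
  2 * (k / 2) + k % 2
    ≡⟨ trans (+-comm _ (k % 2)) (cong (k % 2 +_) (*-comm 2 (k / 2))) ⟩
  k % 2 + k / 2 * 2
    ≡⟨ m≡m%n+[m/n]*n k 2 ⟨
  k ∎
  where
  open ≡-Reasoning
  k/2<2^n : k / 2 < 2 ^ n
  k/2<2^n = m<n*o⇒m/o<n (subst (k <_) (*-comm 2 (2 ^ n)) k<2^[1+n])

binaryValue-∑ : ∀ {n N} (g : Fin N → Fin n → ℕ) →
  binaryValue (tabulate (λ i → ∑[ x < N ] g x i)) ≡ ∑[ x < N ] binaryValue (tabulate (g x))
binaryValue-∑ {zero}  {N} g = sym (sum-replicate-zero N)
binaryValue-∑ {suc n} {N} g = begin
  (∑[ x < N ] g x zero) * 2 ^ n + binaryValue (tabulate (λ i → ∑[ x < N ] g x (suc i)))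
    ≡⟨ cong₂ _+_ (*-distribʳ-sum (2 ^ n) (λ x → g x zero))
                 (binaryValue-∑ (λ x i → g x (suc i))) ⟩
  ∑[ x < N ] (g x zero * 2 ^ n) + ∑[ x < N ] binaryValue (tabulate (λ i → g x (suc i)))
    ≡⟨ ∑-distrib-+ (λ x → g x zero * 2 ^ n)
                   (λ x → binaryValue (tabulate (λ i → g x (suc i)))) ⟨
  ∑[ x < N ] binaryValue (tabulate (g x))
    ∎
  where open ≡-Reasoning

binaryValue-m : ∀ n (S : Subset (2 ^ n)) → binaryValue (m n S) ≡ elementSum S
binaryValue-m n S = begin
  binaryValue (tabulate (λ i → count (λ x → lookup S x ∧ lookup (str n x) i)))
    ≡⟨ cong binaryValue (tabulate-cong (λ i → count≡∑ (λ x → lookup S x ∧ lookup (str n x) i))) ⟩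
  binaryValue (tabulate (λ i → ∑[ x < 2 ^ n ] 𝟙 (lookup S x ∧ lookup (str n x) i)))
    ≡⟨ binaryValue-∑ (λ x i → 𝟙 (lookup S x ∧ lookup (str n x) i)) ⟩
  ∑[ x < 2 ^ n ] binaryValue (tabulate (λ i → 𝟙 (lookup S x ∧ lookup (str n x) i)))
    ≡⟨ sum-cong-≗ (λ x → binaryValue-str (lookup S x) x) ⟩
  ∑[ x < 2 ^ n ] (𝟙 (lookup S x) * toℕ x)
    ≡⟨ elementSum≡∑ S ⟨
  elementSum S
    ∎
  where
  open ≡-Reasoning
  binaryValue-str : ∀ b x → binaryValue (tabulate (λ i → 𝟙 (b ∧ lookup (str n x) i))) ≡ 𝟙 b * toℕ x
  binaryValue-str false x = binaryValue-∑ {n} {0} (λ ())  -- the zero vector as an empty sum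
  binaryValue-str true  x = begin
    binaryValue (tabulate (λ i → 𝟙 (lookup (str n x) i)))
      ≡⟨ cong binaryValue (trans (tabulate-∘ 𝟙 (lookup (str n x)))
                                 (cong (map 𝟙) (tabulate∘lookup (str n x)))) ⟩
    binaryValue (map 𝟙 (str n x))
      ≡⟨ binaryValue-toBits n (toℕ x) (toℕ<n x) ⟩
    toℕ x
      ≡⟨ +-identityʳ (toℕ x) ⟨
    1 * toℕ x
      ∎

m≡⇒elementSum≡ : ∀ n (S T : Subset (2 ^ n)) → m n S ≡ m n T → elementSum S ≡ elementSum T
m≡⇒elementSum≡ n S T mS≡mT = begin
  elementSum S        ≡⟨ binaryValue-m n S ⟨
  binaryValue (m n S) ≡⟨ cong binaryValue mS≡mT ⟩
  binaryValue (m n T) ≡⟨ binaryValue-m n T ⟩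
  elementSum T        ∎
  where open ≡-Reasoning

below : (N a : ℕ) → Subset N
below N a = tabulate (λ x → toℕ x <ᵇ a)

∣below∣≤ : ∀ N a → ∣ below N a ∣ ≤ a
∣below∣≤ zero    a       = z≤n
∣below∣≤ (suc N) zero    = ∣below∣≤ N zero
∣below∣≤ (suc N) (suc a) = s≤s (∣below∣≤ N a)

elementSum-below-minimal : ∀ {N} a (S : Subset N) → a ≤ ∣ S ∣ →
  elementSum (below N a) ≤ elementSum S
elementSum-below-minimal         a       []          _        = z≤n
elementSum-below-minimal {suc N} zero    (b ∷ S)     _        =
  +-mono-≤ (≤-trans (∣below∣≤ N 0) z≤n) (elementSum-below-minimal 0 S z≤n)
elementSum-below-minimal {suc N} (suc a) (true  ∷ S) (s≤s a≤) =
  +-mono-≤ (≤-trans (∣below∣≤ N a) a≤) (elementSum-below-minimal a S a≤)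
elementSum-below-minimal {suc N} (suc a) (false ∷ S) 1+a≤     =
  +-mono-≤ (≤-trans (∣below∣≤ N a) a≤) (elementSum-below-minimal a S a≤)
  where
  a≤ : a ≤ ∣ S ∣
  a≤ = ≤-trans (n≤1+n a) 1+a≤

m+n≤o+p⇒o≤m⇒n≤p : ∀ {m n o p} → m + n ≤ o + p → o ≤ m → n ≤ p
m+n≤o+p⇒o≤m⇒n≤p {m} {n} {o} {p} m+n≤o+p o≤m =
  +-cancelˡ-≤ m n p (≤-trans m+n≤o+p (+-monoˡ-≤ p o≤m))

elementSum-below-unique : ∀ {N} a (S : Subset N) → ∣ S ∣ ≡ a →
  elementSum S ≤ elementSum (below N a) → S ≡ below N a
elementSum-below-unique         a       []          _       _      = refl
elementSum-below-unique {suc N} zero    (false ∷ S) ∣S∣≡0   ≤below =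
  cong (false ∷_) (elementSum-below-unique 0 S ∣S∣≡0
    (m+n≤o+p⇒o≤m⇒n≤p ≤below (≤-trans (∣below∣≤ N 0) z≤n)))
elementSum-below-unique {suc N} (suc a) (true  ∷ S) ∣S∣≡1+a ≤below =
  cong (true ∷_) (elementSum-below-unique a S ∣S∣≡a
    (m+n≤o+p⇒o≤m⇒n≤p ≤below (≤-trans (∣below∣≤ N a) (≤-reflexive (sym ∣S∣≡a)))))
  where
  ∣S∣≡a : ∣ S ∣ ≡ a
  ∣S∣≡a = suc-injective ∣S∣≡1+a
elementSum-below-unique {suc N} (suc a) (false ∷ S) ∣S∣≡1+a ≤below =
  contradiction ≤below (<⇒≱ below<S)
  where
  1+a≤∣S∣ : suc a ≤ ∣ S ∣
  1+a≤∣S∣ = ≤-reflexive (sym ∣S∣≡1+a)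
  below<S : ∣ below N a ∣ + elementSum (below N a) < ∣ S ∣ + elementSum S
  below<S = +-mono-<-≤ (≤-trans (s≤s (∣below∣≤ N a)) 1+a≤∣S∣)
                       (elementSum-below-minimal a S (≤-trans (n≤1+n a) 1+a≤∣S∣))

mainTheorem3 : (n a : ℕ) → a ≤ 2 ^ n → (S : Subset (2 ^ n)) → ∣ S ∣ ≡ a →
    (m n (I n a) ≡ m n S ⇔ I n a ≡ S)
mainTheorem3 n a _ S ∣S∣≡a = mk⇔ to (cong (m n))
  where
  to : m n (I n a) ≡ m n S → I n a ≡ S
  to m≡ = sym (elementSum-below-unique a S ∣S∣≡a
                 (≤-reflexive (m≡⇒elementSum≡ n S (I n a) (sym m≡))))
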